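{- If $G$ is a strongly $\theta$-prime graph, then $G$ is $1$-well-covered.
   Context: For a finite simple graph $G$, $\theta(G)$ is defined recursively by: $\theta(G)=0$ if $G$ has no edges, and otherwise $\theta(G)=\min_{v}\max\{\theta(G-v),\ \theta(G-N_G[v])+1\}$, the minimum over non-isolated vertices $v$, where $N_G[v]$ is the closed neighborhood of $v$ (this is the theta-number of the independence complex of $G$). $G$ is $\theta$-prime if $\theta(G-v)<\theta(G)$ for every vertex $v$ of $G$ (the graph with no vertices counts as $\theta$-prime). A $\theta$-prime graph $G$ is strongly $\theta$-prime if either $G$ has no vertices or $G-N_G[x]$ is strongly $\theta$-prime for every vertex $x$ of $G$. A graph is well-covered if all its maximal independent sets have the same size, and $1$-well-covered if it is well-covered and $G-x$ is well-covered for every vertex $x$. -}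

module Defs where

open import Data.Bool using (Bool; true; false; _∧_; _∨_; not; if_then_else_)
open import Data.Nat using (ℕ; zero; suc; _+_; _<_; _⊔_; _⊓_)
open import Data.Fin using (Fin)
open import Data.Fin.Subset using (Subset; _∈_; _⊆_; _-_; ∣_∣; ∁; _∩_)
open import Data.Vec using (Vec; lookup; tabulate)
open import Data.List using (List; []; _∷_; foldr; map; filterᵇ)
open import Data.List.Base using (allFin)
open import Data.Maybe using (Maybe; just; nothing)
open import Data.Product using (_×_)
open import Relation.Binary.PropositionalEquality using (_≡_)

record Graph : Set where
  field
    n     : ℕ
    adj   : Fin n → Fin n → Bool
    sym   : ∀ u v → adj u v ≡ adj v u
    irrfl : ∀ v → adj v v ≡ false

open Graph public

-- Induced subgraphs of G are represented by their vertex sets S : Subset (n G).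

mem : ∀ {m} → Fin m → Subset m → Bool
mem v S = lookup S v

hasNbrIn : (G : Graph) → Subset (n G) → Fin (n G) → Bool
hasNbrIn G S v = foldr (λ u b → (mem u S ∧ adj G v u) ∨ b) false (allFin (n G))

nonIsolated : (G : Graph) → Subset (n G) → Fin (n G) → Bool
nonIsolated G S v = mem v S ∧ hasNbrIn G S v

hasEdge : (G : Graph) → Subset (n G) → Bool
hasEdge G S = foldr (λ v b → nonIsolated G S v ∨ b) false (allFin (n G))

closedNbhd : (G : Graph) → Fin (n G) → Subset (n G)
closedNbhd G v = tabulate (λ u → adj G v u ∨ isSame u)
  where
    open import Data.Fin using (_≟_)
    open import Relation.Nullary using (does)
    isSame : Fin (n G) → Bool
    isSame u = does (u ≟ v)

-- vertex set of G[S] - N_{G[S]}[v]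
removeClosedNbhd : (G : Graph) → Subset (n G) → Fin (n G) → Subset (n G)
removeClosedNbhd G S v = S ∩ ∁ (closedNbhd G v)

minList : List ℕ → Maybe ℕ
minList = foldr step nothing
  where
    step : ℕ → Maybe ℕ → Maybe ℕ
    step a nothing  = just a
    step a (just b) = just (a ⊓ b)

fromMaybe0 : Maybe ℕ → ℕ
fromMaybe0 nothing  = 0
fromMaybe0 (just a) = a

-- θ with fuel: θ-fuel f S computes θ(G[S]) correctly whenever f ≥ |S|,
-- since each recursive call removes at least one vertex of S.
θ-fuel : (G : Graph) → ℕ → Subset (n G) → ℕ
θ-fuel G zero    S = 0
θ-fuel G (suc f) S =
  if hasEdge G S
  then fromMaybe0 (minList (map value (filterᵇ (nonIsolated G S) (allFin (n G)))))
  else 0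
  where
    value : Fin (n G) → ℕ
    value v = θ-fuel G f (S - v) ⊔ suc (θ-fuel G f (removeClosedNbhd G S v))

θ : (G : Graph) → Subset (n G) → ℕ
θ G S = θ-fuel G (n G) S

θ-Prime : (G : Graph) → Subset (n G) → Set
θ-Prime G S = ∀ v → v ∈ S → θ G (S - v) < θ G S

-- G[S] is strongly θ-prime (inductive; the empty graph satisfies it vacuously)
data StronglyθPrime (G : Graph) (S : Subset (n G)) : Set where
  strong : θ-Prime G S
         → (∀ x → x ∈ S → StronglyθPrime G (removeClosedNbhd G S x))
         → StronglyθPrime G S

Independent : (G : Graph) → Subset (n G) → Subset (n G) → Set
Independent G S T = T ⊆ S × (∀ u v → u ∈ T → v ∈ T → adj G u v ≡ false)

MaximalIndependent : (G : Graph) → Subset (n G) → Subset (n G) → Set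
MaximalIndependent G S T =
  Independent G S T ×
  (∀ T' → Independent G S T' → T ⊆ T' → T' ⊆ T)

WellCovered : (G : Graph) → Subset (n G) → Set
WellCovered G S = ∀ T T' → MaximalIndependent G S T → MaximalIndependent G S T' → ∣ T ∣ ≡ ∣ T' ∣

OneWellCovered : (G : Graph) → Subset (n G) → Set
OneWellCovered G S = WellCovered G S × (∀ x → x ∈ S → WellCovered G (S - x))

-- In a θ-prime graph G every vertex x satisfies θ(G) = 1 + θ(G − N[x]): θ is monotone
-- under induced subgraphs, so θ(G − N[x]) ≤ θ(G − x) < θ(G); conversely x is not isolated
-- (deleting an isolated vertex does not lower θ), so the recursion at x bounds θ(G) by
-- max(θ(G − x), 1 + θ(G − N[x])), and the first term is too small to be the maximum.
-- Deleting N[t] for a vertex t of an independent dominating set T leaves T − t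
-- independent and dominating, so in a strongly θ-prime graph induction gives |T| = θ(G).
-- Maximal independent sets are dominating, hence G is well-covered. A maximal independent
-- set T of G − x also dominates x: otherwise, deleting N[t] for t ∈ T one vertex at a time
-- keeps x and ends in a θ-prime graph in which x is isolated.

module Submission where

open import Defs hiding (sym)
open import Data.Bool using (Bool; true; false; _∧_; _∨_)
import Data.Bool as Bool
open import Data.Bool.Properties using (∨-zeroʳ)
open import Data.Empty using (⊥-elim)
open import Data.Fin using (Fin; _≟_)
open import Data.Fin.Properties using (any?)
open import Data.Fin.Subset
  using (Subset; _∈_; _∉_; _⊆_; _─_; _-_; inside; outside; ∣_∣; ∁; _∪_; ⁅_⁆; Empty; ⊤; ⊥)
open import Data.Fin.Subset.Properties
  using (_∈?_; nonempty?; Empty-unique; ⊆-antisym; ∣⊥∣≡0; ∣p∣≤n; p⊆q⇒∣p∣≤∣q∣; x∈p⇒∣p-x∣<∣p∣;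
         p─⊥≡p; p─q⊆p; x∈p∧x≢y⇒x∈p-y; p─x─y≡p─y─x; x∉⁅y⁆⇒x≢y; x∈⁅y⁆⇒x≡y; x∈⁅x⁆;
         x∈p∩q⁺; x∈p∩q⁻; x∈∁p⇒x∉p; x∉p⇒x∈∁p; x∈p∪q⁻; p⊆p∪q; q⊆p∪q)
open import Data.List using (List; []; _∷_; foldr; map; filterᵇ; allFin)
import Data.List.Relation.Unary.Any as Any
open import Data.List.Membership.Propositional using () renaming (_∈_ to _∈ₗ_)
open import Data.List.Membership.Propositional.Properties using (∈-allFin)
open import Data.Maybe using (Maybe; just; nothing)
open import Data.Nat using (ℕ; zero; suc; _≤_; _<_; _⊔_; _⊓_; z≤n; s≤s)
open import Data.Nat.Induction using (<-wellFounded)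
open import Data.Nat.Properties
  using (≤-refl; ≤-reflexive; ≤-trans; ≤-<-trans; ≤-pred; ≤-antisym; m≤n⇒m≤1+n; <⇒≱; ≰⇒≥; _≤?_;
         m⊓n≤m; m⊓n≤n; m≤n⇒m⊓n≡m; m≥n⇒m⊓n≡n; m≤m⊔n; ⊔-mono-≤; ⊔-sel; module ≤-Reasoning)
open import Data.Product using (∃; _×_; _,_; proj₁; proj₂)
open import Data.Sum using (_⊎_; inj₁; inj₂)
open import Data.Vec using (lookup; _∷_; here; there)
open import Data.Vec.Properties using (lookup∘tabulate; []=⇒lookup; lookup⇒[]=)
open import Function using (_∘_)
open import Induction.WellFounded using (Acc; acc)
open import Relation.Binary.PropositionalEquality
  using (_≡_; _≢_; refl; sym; trans; cong; cong₂; subst; module ≡-Reasoning)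
open import Relation.Nullary using (¬_; Dec; yes; no)
open import Relation.Nullary.Decidable using (_×-dec_; dec-true; dec-false)

anyᵇ-witness : ∀ {A : Set} (P : A → Bool) (xs : List A) →
               foldr (λ u b → P u ∨ b) false xs ≡ true → ∃ λ u → P u ≡ true
anyᵇ-witness P (x ∷ xs) e with P x in Px
... | true  = x , Px
... | false = anyᵇ-witness P xs e

anyᵇ-intro : ∀ {A : Set} (P : A → Bool) {xs : List A} {u : A} →
             u ∈ₗ xs → P u ≡ true → foldr (λ u b → P u ∨ b) false xs ≡ true
anyᵇ-intro P (Any.here refl) Pu rewrite Pu = refl
anyᵇ-intro P {x ∷ _} (Any.there u∈xs) Pu with P x
... | true  = refl
... | false = anyᵇ-intro P u∈xs Pu

module _ {A : Set} (p : A → Bool) where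

  minOver : (A → ℕ) → List A → Maybe ℕ
  minOver g xs = minList (map g (filterᵇ p xs))

  minOver-≤ : ∀ g {xs v} → v ∈ₗ xs → p v ≡ true → ∃ λ m → minOver g xs ≡ just m × m ≤ g v
  minOver-≤ g {x ∷ xs} (Any.here refl) pv rewrite pv with minOver g xs
  ... | nothing = g x , refl , ≤-refl
  ... | just m  = g x ⊓ m , refl , m⊓n≤m (g x) m
  minOver-≤ g {x ∷ xs} (Any.there v∈xs) pv with p x | minOver-≤ g v∈xs pv
  ... | false | r = r
  ... | true  | m , e , m≤gv rewrite e = g x ⊓ m , refl , ≤-trans (m⊓n≤n (g x) m) m≤gv

  minOver-nothing-or-attained : ∀ g xs →
    minOver g xs ≡ nothing ⊎ ∃ λ v → p v ≡ true × minOver g xs ≡ just (g v)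
  minOver-nothing-or-attained g [] = inj₁ refl
  minOver-nothing-or-attained g (x ∷ xs) with p x in px
  ... | false = minOver-nothing-or-attained g xs
  ... | true with minOver-nothing-or-attained g xs
  ...   | inj₁ e rewrite e = inj₂ (x , px , refl)
  ...   | inj₂ (w , pw , e) rewrite e with g x ≤? g w
  ...     | yes gx≤gw = inj₂ (x , px , cong just (m≤n⇒m⊓n≡m gx≤gw))
  ...     | no  gx≰gw = inj₂ (w , pw , cong just (m≥n⇒m⊓n≡n (≰⇒≥ gx≰gw)))

  minOver-attained : ∀ g {xs v} → v ∈ₗ xs → p v ≡ true → ∃ λ w → p w ≡ true × minOver g xs ≡ just (g w)
  minOver-attained g {xs} v∈xs pv with minOver-nothing-or-attained g xs | minOver-≤ g v∈xs pv
  ... | inj₂ attained | _ = attained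
  ... | inj₁ ≡nothing | _ , ≡just , _ with trans (sym ≡nothing) ≡just
  ...   | ()

  minOver-cong : ∀ {f g} xs → (∀ x → p x ≡ true → f x ≡ g x) → minOver f xs ≡ minOver g xs
  minOver-cong {f} {g} xs f≗g = cong minList (map-filter xs)
    where
    map-filter : ∀ xs → map f (filterᵇ p xs) ≡ map g (filterᵇ p xs)
    map-filter [] = refl
    map-filter (x ∷ xs) with p x in px
    ... | false = map-filter xs
    ... | true  = cong₂ _∷_ (f≗g x px) (map-filter xs)

x∈p─q⇒x∉q : ∀ {m} {p q : Subset m} {x : Fin m} → x ∈ p ─ q → x ∉ q
x∈p─q⇒x∉q {p = inside ∷ _} {outside ∷ _} here ()
x∈p─q⇒x∉q {p = _ ∷ _} {_ ∷ _} (there x∈p─q) (there x∈q) = x∈p─q⇒x∉q x∈p─q x∈q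

x∈p-y⇒x∈p : ∀ {m} {p : Subset m} {x y : Fin m} → x ∈ p - y → x ∈ p
x∈p-y⇒x∈p = p─q⊆p _ _

x∈p-y⇒x≢y : ∀ {m} {p : Subset m} {x y : Fin m} → x ∈ p - y → x ≢ y
x∈p-y⇒x≢y x∈p-y = x∉⁅y⁆⇒x≢y (x∈p─q⇒x∉q x∈p-y)

p⊆q⇒p-x⊆q-x : ∀ {m} {p q : Subset m} {x : Fin m} → p ⊆ q → p - x ⊆ q - x
p⊆q⇒p-x⊆q-x p⊆q y∈p-x = x∈p∧x≢y⇒x∈p-y (p⊆q (x∈p-y⇒x∈p y∈p-x)) (x∈p-y⇒x≢y y∈p-x)

x∈p⇒∣p∣≡1+∣p-x∣ : ∀ {m} {p : Subset m} {x : Fin m} → x ∈ p → ∣ p ∣ ≡ suc ∣ p - x ∣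
x∈p⇒∣p∣≡1+∣p-x∣ {p = inside ∷ p} here = cong suc (sym (cong ∣_∣ (p─⊥≡p p)))
x∈p⇒∣p∣≡1+∣p-x∣ {p = inside ∷ _} (there x∈p) = cong suc (x∈p⇒∣p∣≡1+∣p-x∣ x∈p)
x∈p⇒∣p∣≡1+∣p-x∣ {p = outside ∷ _} (there x∈p) = x∈p⇒∣p∣≡1+∣p-x∣ x∈p

x∉p⇒p-x≡p : ∀ {m} {p : Subset m} {x : Fin m} → x ∉ p → p - x ≡ p
x∉p⇒p-x≡p x∉p = ⊆-antisym x∈p-y⇒x∈p (λ y∈p → x∈p∧x≢y⇒x∈p-y y∈p λ { refl → x∉p y∈p })

∣p∣≤0⇒Empty : ∀ {m} {p : Subset m} → ∣ p ∣ ≤ 0 → Empty p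
∣p∣≤0⇒Empty p≤0 (x , x∈p) = <⇒≱ (x∈p⇒∣p-x∣<∣p∣ x∈p) (≤-trans p≤0 z≤n)

module _ (G : Graph) where

  Vertex : Set
  Vertex = Fin (n G)

  infixl 5 _∖N[_]
  _∖N[_] : Subset (n G) → Vertex → Subset (n G)
  S ∖N[ v ] = removeClosedNbhd G S v

  closedNbhd-adj : ∀ {v u} → adj G v u ≡ true → u ∈ closedNbhd G v
  closedNbhd-adj {v} {u} a = lookup⇒[]= u _ (trans (lookup∘tabulate _ u) (cong (_∨ _) a))

  closedNbhd-self : ∀ v → v ∈ closedNbhd G v
  closedNbhd-self v = lookup⇒[]= v _
    (trans (lookup∘tabulate _ v) (trans (cong (adj G v v ∨_) (dec-true (v ≟ v) refl)) (∨-zeroʳ _)))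

  ∉closedNbhd⁺ : ∀ {v u} → adj G v u ≡ false → u ≢ v → u ∉ closedNbhd G v
  ∉closedNbhd⁺ {v} {u} a u≢v u∈N
    with trans (sym ([]=⇒lookup u∈N)) (trans (lookup∘tabulate _ u) (cong₂ _∨_ a (dec-false (u ≟ v) u≢v)))
  ... | ()

  ∉closedNbhd⁻ : ∀ {v u} → u ∉ closedNbhd G v → adj G v u ≡ false × u ≢ v
  ∉closedNbhd⁻ {v} {u} u∉N = nonadjacent , λ { refl → u∉N (closedNbhd-self v) }
    where
    nonadjacent : adj G v u ≡ false
    nonadjacent with adj G v u in a
    ... | true  = ⊥-elim (u∉N (closedNbhd-adj a))
    ... | false = refl

  ∈∖N⁺ : ∀ {S v u} → u ∈ S → adj G v u ≡ false → u ≢ v → u ∈ S ∖N[ v ]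
  ∈∖N⁺ u∈S a u≢v = x∈p∩q⁺ (u∈S , x∉p⇒x∈∁p (∉closedNbhd⁺ a u≢v))

  ∈∖N⁻ : ∀ {S v u} → u ∈ S ∖N[ v ] → u ∈ S × adj G v u ≡ false × u ≢ v
  ∈∖N⁻ {S} {v} u∈S∖N with x∈p∩q⁻ S (∁ (closedNbhd G v)) u∈S∖N
  ... | u∈S , u∈∁N = u∈S , ∉closedNbhd⁻ (x∈∁p⇒x∉p u∈∁N)

  ∖N⊆- : ∀ {S v} → S ∖N[ v ] ⊆ S - v
  ∖N⊆- u∈S∖N with ∈∖N⁻ u∈S∖N
  ... | u∈S , _ , u≢v = x∈p∧x≢y⇒x∈p-y u∈S u≢v

  ∖N-mono : ∀ {S S' v} → S' ⊆ S → S' ∖N[ v ] ⊆ S ∖N[ v ]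
  ∖N-mono S'⊆S u∈S'∖N with ∈∖N⁻ u∈S'∖N
  ... | u∈S' , a , u≢v = ∈∖N⁺ (S'⊆S u∈S') a u≢v

  p∖N[y]-x≡p-x∖N[y] : ∀ S v w → S ∖N[ w ] - v ≡ (S - v) ∖N[ w ]
  p∖N[y]-x≡p-x∖N[y] S v w = ⊆-antisym to from
    where
    to : S ∖N[ w ] - v ⊆ (S - v) ∖N[ w ]
    to u∈ with ∈∖N⁻ (x∈p-y⇒x∈p u∈)
    ... | u∈S , a , u≢w = ∈∖N⁺ (x∈p∧x≢y⇒x∈p-y u∈S (x∈p-y⇒x≢y u∈)) a u≢w
    from : (S - v) ∖N[ w ] ⊆ S ∖N[ w ] - v
    from u∈ with ∈∖N⁻ u∈
    ... | u∈S-v , a , u≢w = x∈p∧x≢y⇒x∈p-y (∈∖N⁺ (x∈p-y⇒x∈p u∈S-v) a u≢w) (x∈p-y⇒x≢y u∈S-v)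

  nonIsolated⁻ : ∀ {S v} → nonIsolated G S v ≡ true → v ∈ S × ∃ λ u → u ∈ S × adj G v u ≡ true
  nonIsolated⁻ {S} {v} nv with lookup S v in v∈S
  ... | true with anyᵇ-witness (λ u → lookup S u ∧ adj G v u) (allFin (n G)) nv
  ...   | u , u∈S∧a with lookup S u in u∈S
  ...     | true = lookup⇒[]= v S v∈S , u , lookup⇒[]= u S u∈S , u∈S∧a

  nonIsolated⁺ : ∀ {S v u} → v ∈ S → u ∈ S → adj G v u ≡ true → nonIsolated G S v ≡ true
  nonIsolated⁺ {S} {v} {u} v∈S u∈S a rewrite []=⇒lookup v∈S =
    anyᵇ-intro (λ u → lookup S u ∧ adj G v u) (∈-allFin u) (trans (cong (_∧ adj G v u) ([]=⇒lookup u∈S)) a)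

  nonIsolated-mono : ∀ {S S' v} → S' ⊆ S → nonIsolated G S' v ≡ true → nonIsolated G S v ≡ true
  nonIsolated-mono S'⊆S nv with nonIsolated⁻ nv
  ... | v∈S' , u , u∈S' , a = nonIsolated⁺ (S'⊆S v∈S') (S'⊆S u∈S') a

  hasEdge⁻ : ∀ {S} → hasEdge G S ≡ true → ∃ λ v → nonIsolated G S v ≡ true
  hasEdge⁻ {S} = anyᵇ-witness (nonIsolated G S) (allFin (n G))

  hasEdge⁺ : ∀ {S v} → nonIsolated G S v ≡ true → hasEdge G S ≡ true
  hasEdge⁺ {S} {v} = anyᵇ-intro (nonIsolated G S) (∈-allFin v)

  NoNbrIn : Subset (n G) → Vertex → Set
  NoNbrIn S v = ∀ u → u ∈ S → adj G v u ≡ false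

  isolated⇒NoNbrIn : ∀ {S v} → v ∈ S → nonIsolated G S v ≡ false → NoNbrIn S v
  isolated⇒NoNbrIn {S} {v} v∈S iso u u∈S with adj G v u in a
  ... | false = refl
  ... | true with trans (sym (nonIsolated⁺ v∈S u∈S a)) iso
  ...   | ()

  nonIsolated-shrinks : ∀ {S v} → nonIsolated G S v ≡ true → ∣ S - v ∣ < ∣ S ∣ × ∣ S ∖N[ v ] ∣ < ∣ S ∣
  nonIsolated-shrinks {S} {v} nv = S-v<S , ≤-<-trans (p⊆q⇒∣p∣≤∣q∣ (∖N⊆- {S} {v})) S-v<S
    where
    S-v<S : ∣ S - v ∣ < ∣ S ∣
    S-v<S = x∈p⇒∣p-x∣<∣p∣ (proj₁ (nonIsolated⁻ {S} nv))

  noEdge-empty : ∀ {S} → Empty S → hasEdge G S ≡ false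
  noEdge-empty {S} S-empty with hasEdge G S in e
  ... | false = refl
  ... | true with hasEdge⁻ {S} e
  ...   | v , nv = ⊥-elim (S-empty (v , proj₁ (nonIsolated⁻ {S} nv)))

  valueFuel : ℕ → Subset (n G) → Vertex → ℕ
  valueFuel f S v = θ-fuel G f (S - v) ⊔ suc (θ-fuel G f (S ∖N[ v ]))

  value : Subset (n G) → Vertex → ℕ
  value = valueFuel (n G)

  θ-fuel-noEdge : ∀ {S} → hasEdge G S ≡ false → ∀ f → θ-fuel G f S ≡ 0
  θ-fuel-noEdge e zero = refl
  θ-fuel-noEdge {S} e (suc f) rewrite e = refl

  θ-fuel-hasEdge : ∀ {S} → hasEdge G S ≡ true → ∀ f →
                   θ-fuel G (suc f) S ≡ fromMaybe0 (minOver (nonIsolated G S) (valueFuel f S) (allFin (n G)))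
  θ-fuel-hasEdge {S} e f rewrite e = refl

  θ-fuel-irrelevant : ∀ f g {S} → ∣ S ∣ ≤ f → ∣ S ∣ ≤ g → θ-fuel G f S ≡ θ-fuel G g S
  θ-fuel-irrelevant zero g {S} S≤0 _ = sym (θ-fuel-noEdge (noEdge-empty (∣p∣≤0⇒Empty {p = S} S≤0)) g)
  θ-fuel-irrelevant (suc f) zero {S} _ S≤0 = θ-fuel-noEdge (noEdge-empty (∣p∣≤0⇒Empty {p = S} S≤0)) (suc f)
  θ-fuel-irrelevant (suc f) (suc g) {S} S≤1+f S≤1+g with hasEdge G S
  ... | false = refl
  ... | true  = cong fromMaybe0 (minOver-cong (nonIsolated G S) (allFin (n G)) same-value)
    where
    same-value : ∀ v → nonIsolated G S v ≡ true → valueFuel f S v ≡ valueFuel g S v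
    same-value v nv with nonIsolated-shrinks {S} nv
    ... | S-v<S , S∖N<S =
      cong₂ _⊔_ (θ-fuel-irrelevant f g (below S-v<S S≤1+f) (below S-v<S S≤1+g))
                (cong suc (θ-fuel-irrelevant f g (below S∖N<S S≤1+f) (below S∖N<S S≤1+g)))
      where
      below : ∀ {a b c} → a < b → b ≤ suc c → a ≤ c
      below a<b b≤1+c = ≤-pred (≤-trans a<b b≤1+c)

  θ-noEdge : ∀ {S} → hasEdge G S ≡ false → θ G S ≡ 0
  θ-noEdge e = θ-fuel-noEdge e (n G)

  θ-hasEdge : ∀ {S} → hasEdge G S ≡ true →
              θ G S ≡ fromMaybe0 (minOver (nonIsolated G S) (value S) (allFin (n G)))
  θ-hasEdge {S} e =
    trans (θ-fuel-irrelevant (n G) (suc (n G)) (∣p∣≤n S) (m≤n⇒m≤1+n (∣p∣≤n S))) (θ-fuel-hasEdge e (n G))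

  θ-≤-value : ∀ {S v} → nonIsolated G S v ≡ true → θ G S ≤ value S v
  θ-≤-value {S} {v} nv with minOver-≤ (nonIsolated G S) (value S) (∈-allFin v) nv
  ... | m , min≡m , m≤ =
    subst (_≤ value S v) (sym (trans (θ-hasEdge (hasEdge⁺ {S} nv)) (cong fromMaybe0 min≡m))) m≤

  θ-attained : ∀ {S} → hasEdge G S ≡ true → ∃ λ v → nonIsolated G S v ≡ true × θ G S ≡ value S v
  θ-attained {S} e with hasEdge⁻ {S} e
  ... | v , nv with minOver-attained (nonIsolated G S) (value S) (∈-allFin v) nv
  ...   | w , nw , min≡w = w , nw , trans (θ-hasEdge e) (cong fromMaybe0 min≡w)

  hasEdge-removeNoNbr : ∀ {S v} → NoNbrIn S v → hasEdge G S ≡ true → hasEdge G (S - v) ≡ true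
  hasEdge-removeNoNbr {S} {v} v⊥S e with hasEdge⁻ {S} e
  ... | w , nw with nonIsolated⁻ {S} nw
  ...   | w∈S , u , u∈S , w~u =
    hasEdge⁺ {S - v} (nonIsolated⁺ (x∈p∧x≢y⇒x∈p-y w∈S w≢v) (x∈p∧x≢y⇒x∈p-y u∈S u≢v) w~u)
    where
    w≢v : w ≢ v
    w≢v refl with trans (sym (v⊥S u u∈S)) w~u
    ... | ()
    u≢v : u ≢ v
    u≢v refl with trans (sym (v⊥S w w∈S)) (trans (Graph.sym G v w) w~u)
    ... | ()

  θ-≤-removeNoNbr : ∀ {S v} → NoNbrIn S v → θ G S ≤ θ G (S - v)
  θ-≤-removeNoNbr {S} = go (<-wellFounded ∣ S ∣)
    where
    go : ∀ {S v} → Acc _<_ ∣ S ∣ → NoNbrIn S v → θ G S ≤ θ G (S - v)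
    go {S} {v} (acc rec) v⊥S with hasEdge G S in e
    ... | false = subst (_≤ θ G (S - v)) (sym (θ-noEdge e)) z≤n
    ... | true with θ-attained {S - v} (hasEdge-removeNoNbr v⊥S e)
    ...   | w , nw , θ≡ = begin
      θ G S                                            ≤⟨ θ-≤-value nwS ⟩
      θ G (S - w) ⊔ suc (θ G (S ∖N[ w ]))              ≤⟨ ⊔-mono-≤ removed (s≤s removed∖N) ⟩
      θ G (S - v - w) ⊔ suc (θ G ((S - v) ∖N[ w ]))    ≡⟨ sym θ≡ ⟩
      θ G (S - v)                                      ∎
      where
      open ≤-Reasoning
      nwS : nonIsolated G S w ≡ true
      nwS = nonIsolated-mono {S} {S - v} x∈p-y⇒x∈p nw
      removed : θ G (S - w) ≤ θ G (S - v - w)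
      removed = subst (λ X → θ G (S - w) ≤ θ G X) (p─x─y≡p─y─x S w v)
        (go (rec (proj₁ (nonIsolated-shrinks {S} nwS))) (λ u h → v⊥S u (x∈p-y⇒x∈p h)))
      removed∖N : θ G (S ∖N[ w ]) ≤ θ G ((S - v) ∖N[ w ])
      removed∖N = subst (λ X → θ G (S ∖N[ w ]) ≤ θ G X) (p∖N[y]-x≡p-x∖N[y] S v w)
        (go (rec (proj₂ (nonIsolated-shrinks {S} nwS))) (λ u h → v⊥S u (proj₁ (∈∖N⁻ h))))

  θ-≤-removeIsolated : ∀ {S v} → nonIsolated G S v ≡ false → θ G S ≤ θ G (S - v)
  θ-≤-removeIsolated {S} {v} iso with v ∈? S
  ... | yes v∈S = θ-≤-removeNoNbr (isolated⇒NoNbrIn v∈S iso)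
  ... | no  v∉S = ≤-reflexive (cong (θ G) (sym (x∉p⇒p-x≡p v∉S)))

  θ-mono : ∀ {S S'} → S' ⊆ S → θ G S' ≤ θ G S
  θ-mono {S} = go (<-wellFounded ∣ S ∣)
    where
    go : ∀ {S S'} → Acc _<_ ∣ S ∣ → S' ⊆ S → θ G S' ≤ θ G S
    go {S} {S'} (acc rec) S'⊆S with hasEdge G S' in e'
    ... | false = subst (_≤ θ G S) (sym (θ-noEdge e')) z≤n
    ... | true with hasEdge⁻ {S'} e'
    ...   | u , nu with θ-attained {S} (hasEdge⁺ {S} (nonIsolated-mono S'⊆S nu))
    ...     | v , nv , θ≡ = subst (θ G S' ≤_) (sym θ≡) bound
      where
      removed : θ G (S' - v) ≤ θ G (S - v)
      removed = go (rec (proj₁ (nonIsolated-shrinks {S} nv))) (p⊆q⇒p-x⊆q-x S'⊆S)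
      removed∖N : θ G (S' ∖N[ v ]) ≤ θ G (S ∖N[ v ])
      removed∖N = go (rec (proj₂ (nonIsolated-shrinks {S} nv))) (∖N-mono S'⊆S)
      bound : θ G S' ≤ value S v
      bound with nonIsolated G S' v in nv'
      ... | true  = ≤-trans (θ-≤-value nv') (⊔-mono-≤ removed (s≤s removed∖N))
      ... | false = ≤-trans (θ-≤-removeIsolated nv') (≤-trans removed (m≤m⊔n _ _))

  θ-Prime⇒nonIsolated : ∀ {S x} → θ-Prime G S → x ∈ S → nonIsolated G S x ≡ true
  θ-Prime⇒nonIsolated {S} {x} prime x∈S with nonIsolated G S x in nx
  ... | true  = refl
  ... | false = ⊥-elim (<⇒≱ (prime x x∈S) (θ-≤-removeIsolated nx))

  θ-Prime⇒θ≡1+θ∖N : ∀ {S x} → θ-Prime G S → x ∈ S → θ G S ≡ suc (θ G (S ∖N[ x ]))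
  θ-Prime⇒θ≡1+θ∖N {S} {x} prime x∈S = ≤-antisym upper lower
    where
    lower : suc (θ G (S ∖N[ x ])) ≤ θ G S
    lower = ≤-trans (s≤s (θ-mono (∖N⊆- {S} {x}))) (prime x x∈S)
    upper : θ G S ≤ suc (θ G (S ∖N[ x ]))
    upper with ⊔-sel (θ G (S - x)) (suc (θ G (S ∖N[ x ]))) | θ-≤-value (θ-Prime⇒nonIsolated prime x∈S)
    ... | inj₁ ⊔≡removed | θ≤ = ⊥-elim (<⇒≱ (prime x x∈S) (subst (θ G S ≤_) ⊔≡removed θ≤))
    ... | inj₂ ⊔≡∖N      | θ≤ = subst (θ G S ≤_) ⊔≡∖N θ≤

  HasNbrIn : Subset (n G) → Vertex → Set
  HasNbrIn T z = ∃ λ u → u ∈ T × adj G z u ≡ true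

  hasNbrIn? : ∀ T z → Dec (HasNbrIn T z)
  hasNbrIn? T z = any? (λ u → u ∈? T ×-dec (adj G z u Bool.≟ true))

  ¬HasNbrIn⇒NoNbrIn : ∀ {T z} → ¬ HasNbrIn T z → NoNbrIn T z
  ¬HasNbrIn⇒NoNbrIn {T} {z} ¬nbr u u∈T with adj G z u in z~u
  ... | false = refl
  ... | true  = ⊥-elim (¬nbr (u , u∈T , z~u))

  Dominates : Subset (n G) → Subset (n G) → Set
  Dominates S T = ∀ z → z ∈ S → z ∈ T ⊎ HasNbrIn T z

  Independent-insert : ∀ {S T z} → Independent G S T → z ∈ S → NoNbrIn T z → Independent G S (T ∪ ⁅ z ⁆)
  Independent-insert {S} {T} {z} (T⊆S , indep) z∈S z⊥T = T∪z⊆S , indep′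
    where
    T∪z⊆S : T ∪ ⁅ z ⁆ ⊆ S
    T∪z⊆S x∈ with x∈p∪q⁻ T ⁅ z ⁆ x∈
    ... | inj₁ x∈T = T⊆S x∈T
    ... | inj₂ x∈z rewrite x∈⁅y⁆⇒x≡y z x∈z = z∈S
    indep′ : ∀ u w → u ∈ T ∪ ⁅ z ⁆ → w ∈ T ∪ ⁅ z ⁆ → adj G u w ≡ false
    indep′ u w u∈ w∈ with x∈p∪q⁻ T ⁅ z ⁆ u∈ | x∈p∪q⁻ T ⁅ z ⁆ w∈
    ... | inj₁ u∈T | inj₁ w∈T = indep u w u∈T w∈T
    ... | inj₁ u∈T | inj₂ w∈z rewrite x∈⁅y⁆⇒x≡y z w∈z = trans (Graph.sym G u z) (z⊥T u u∈T)
    ... | inj₂ u∈z | inj₁ w∈T rewrite x∈⁅y⁆⇒x≡y z u∈z = z⊥T w w∈T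
    ... | inj₂ u∈z | inj₂ w∈z rewrite x∈⁅y⁆⇒x≡y z u∈z | x∈⁅y⁆⇒x≡y z w∈z = Graph.irrfl G z

  maximal⇒dominates : ∀ {S T} → MaximalIndependent G S T → Dominates S T
  maximal⇒dominates {S} {T} (indT , maximal) z z∈S with hasNbrIn? T z
  ... | yes nbr = inj₂ nbr
  ... | no ¬nbr = inj₁ (maximal (T ∪ ⁅ z ⁆) (Independent-insert indT z∈S (¬HasNbrIn⇒NoNbrIn ¬nbr))
                                 (p⊆p∪q ⁅ z ⁆) (q⊆p∪q T ⁅ z ⁆ (x∈⁅x⁆ z)))

  Independent-∖N : ∀ {S T t} → Independent G S T → t ∈ T → Independent G (S ∖N[ t ]) (T - t)
  Independent-∖N {S} {T} {t} (T⊆S , indep) t∈T =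
    T-t⊆S∖N , λ u w u∈ w∈ → indep u w (x∈p-y⇒x∈p u∈) (x∈p-y⇒x∈p w∈)
    where
    T-t⊆S∖N : T - t ⊆ S ∖N[ t ]
    T-t⊆S∖N u∈T-t = ∈∖N⁺ (T⊆S (x∈p-y⇒x∈p u∈T-t)) (indep t _ t∈T (x∈p-y⇒x∈p u∈T-t)) (x∈p-y⇒x≢y u∈T-t)

  Dominates-∖N : ∀ {S T t} → Dominates S T → Dominates (S ∖N[ t ]) (T - t)
  Dominates-∖N {S} {T} {t} domT z z∈S∖N with ∈∖N⁻ z∈S∖N
  ... | z∈S , t≁z , z≢t with domT z z∈S
  ...   | inj₁ z∈T = inj₁ (x∈p∧x≢y⇒x∈p-y z∈T z≢t)
  ...   | inj₂ (u , u∈T , z~u) = inj₂ (u , x∈p∧x≢y⇒x∈p-y u∈T u≢t , z~u)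
    where
    u≢t : u ≢ t
    u≢t refl with trans (sym t≁z) (trans (Graph.sym G t z) z~u)
    ... | ()

  Dominates-Empty : ∀ {S T} → Empty T → Dominates S T → Empty S
  Dominates-Empty T-empty domT (z , z∈S) with domT z z∈S
  ... | inj₁ z∈T            = T-empty (z , z∈T)
  ... | inj₂ (u , u∈T , _) = T-empty (u , u∈T)

  ∣independentDominating∣≡θ : ∀ {S T} → StronglyθPrime G S →
                              Independent G S T → Dominates S T → ∣ T ∣ ≡ θ G S
  ∣independentDominating∣≡θ {S} {T} (strong prime strong∖N) indT domT with nonempty? T
  ... | yes (t , t∈T) = begin
    ∣ T ∣                  ≡⟨ x∈p⇒∣p∣≡1+∣p-x∣ t∈T ⟩
    suc ∣ T - t ∣          ≡⟨ cong suc (∣independentDominating∣≡θ (strong∖N t t∈S) indT-t domT-t) ⟩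
    suc (θ G (S ∖N[ t ]))  ≡⟨ sym (θ-Prime⇒θ≡1+θ∖N prime t∈S) ⟩
    θ G S                  ∎
    where
    open ≡-Reasoning
    t∈S : t ∈ S
    t∈S = proj₁ indT t∈T
    indT-t : Independent G (S ∖N[ t ]) (T - t)
    indT-t = Independent-∖N indT t∈T
    domT-t : Dominates (S ∖N[ t ]) (T - t)
    domT-t = Dominates-∖N domT
  ... | no T-empty = begin
    ∣ T ∣            ≡⟨ cong ∣_∣ (Empty-unique T-empty) ⟩
    ∣ ⊥ {n G} ∣      ≡⟨ ∣⊥∣≡0 (n G) ⟩
    0                ≡⟨ sym (θ-noEdge (noEdge-empty (Dominates-Empty T-empty domT))) ⟩
    θ G S            ∎
    where open ≡-Reasoning

  dominates-remove⇒¬NoNbrIn : ∀ {S T x} → StronglyθPrime G S → x ∈ S →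
                              Independent G (S - x) T → Dominates (S - x) T → ¬ NoNbrIn T x
  dominates-remove⇒¬NoNbrIn {S} {T} {x} (strong prime strong∖N) x∈S indT domT x⊥T with nonempty? T
  ... | yes (t , t∈T) =
    dominates-remove⇒¬NoNbrIn (strong∖N t t∈S) x∈S∖N indT′ domT′ (λ u u∈T-t → x⊥T u (x∈p-y⇒x∈p u∈T-t))
    where
    t∈S-x : t ∈ S - x
    t∈S-x = proj₁ indT t∈T
    t∈S : t ∈ S
    t∈S = x∈p-y⇒x∈p t∈S-x
    x∈S∖N : x ∈ S ∖N[ t ]
    x∈S∖N = ∈∖N⁺ x∈S (trans (Graph.sym G t x) (x⊥T t t∈T)) (λ x≡t → x∈p-y⇒x≢y t∈S-x (sym x≡t))
    indT′ : Independent G (S ∖N[ t ] - x) (T - t)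
    indT′ = subst (λ X → Independent G X (T - t)) (sym (p∖N[y]-x≡p-x∖N[y] S x t)) (Independent-∖N indT t∈T)
    domT′ : Dominates (S ∖N[ t ] - x) (T - t)
    domT′ = subst (λ X → Dominates X (T - t)) (sym (p∖N[y]-x≡p-x∖N[y] S x t)) (Dominates-∖N domT)
  ... | no T-empty with nonIsolated⁻ {S} (θ-Prime⇒nonIsolated prime x∈S)
  ...   | _ , u , u∈S , x~u = Dominates-Empty T-empty domT (u , x∈p∧x≢y⇒x∈p-y u∈S u≢x)
    where
    u≢x : u ≢ x
    u≢x refl with trans (sym (Graph.irrfl G x)) x~u
    ... | ()

  dominates-remove⇒dominates : ∀ {S T x} → StronglyθPrime G S → x ∈ S →
                               Independent G (S - x) T → Dominates (S - x) T → Dominates S T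
  dominates-remove⇒dominates {T = T} {x} strongS x∈S indT domT z z∈S with z ≟ x
  ... | no z≢x = domT z (x∈p∧x≢y⇒x∈p-y z∈S z≢x)
  ... | yes refl with hasNbrIn? T x
  ...   | yes nbr = inj₂ nbr
  ...   | no ¬nbr = ⊥-elim (dominates-remove⇒¬NoNbrIn strongS x∈S indT domT (¬HasNbrIn⇒NoNbrIn ¬nbr))

  maximal⇒∣T∣≡θ : ∀ {S T} → StronglyθPrime G S → MaximalIndependent G S T → ∣ T ∣ ≡ θ G S
  maximal⇒∣T∣≡θ strongS maxT = ∣independentDominating∣≡θ strongS (proj₁ maxT) (maximal⇒dominates maxT)

  maximal-remove⇒∣T∣≡θ : ∀ {S T x} → StronglyθPrime G S → x ∈ S →
                         MaximalIndependent G (S - x) T → ∣ T ∣ ≡ θ G S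
  maximal-remove⇒∣T∣≡θ strongS x∈S maxT@((T⊆S-x , indep) , _) =
    ∣independentDominating∣≡θ strongS (x∈p-y⇒x∈p ∘ T⊆S-x , indep)
      (dominates-remove⇒dominates strongS x∈S (proj₁ maxT) (maximal⇒dominates maxT))

  constantSize⇒WellCovered : ∀ {S} c → (∀ T → MaximalIndependent G S T → ∣ T ∣ ≡ c) → WellCovered G S
  constantSize⇒WellCovered c size T T′ maxT maxT′ = trans (size T maxT) (sym (size T′ maxT′))

lemma49 : (G : Graph) → StronglyθPrime G ⊤ → OneWellCovered G ⊤
lemma49 G strongG =
  constantSize⇒WellCovered G (θ G ⊤) (λ T → maximal⇒∣T∣≡θ G strongG) ,
  λ x x∈⊤ → constantSize⇒WellCovered G (θ G ⊤) (λ T → maximal-remove⇒∣T∣≡θ G strongG x∈⊤)
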